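{- Let $k\geq 5$ be odd, and let $a,b,c,d\in\mathbb{Z}D_{2k}$, with coefficients in $\{0,1\}$, yield a Kimura Hadamard matrix $H$ of order $8k+4$. Write each $w\in\{a,b,c,d\}$ as $w=w_1+w_2y$ with $w_1,w_2\in\mathbb{Z}\langle x\rangle$. Then $|a_i|<k-1$ and $|b_i|,|c_i|,|d_i|<k$ for each $i\in\{1,2\}$.
   Context: $D_{2k}=\langle x,y\mid x^k=1,\ y^2=1,\ y^{ -1}xy=x^{ -1}\rangle$ is the dihedral group of order $2k$, with elements in the fixed order $x^0,\dots,x^{k-1},y,xy,\dots,x^{k-1}y$ indexing rows and columns of $2k\times 2k$ matrices. $\rho(g)=[\delta_{ug,v}]_{u,v\in D_{2k}}$ is the right regular matrix representation, extended linearly to $\mathbb{Z}D_{2k}$. For $w\in\mathbb{Z}D_{2k}$ with $\{0,1\}$ coefficients, its associated $\pm1$-matrix is $2\rho(w)-J_{2k}$. For $v\in\mathbb{Z}D_{2k}$, $|v|$ denotes the number of nonzero coefficients of $v$. We say $a,b,c,d$ yield the Kimura Hadamard matrix $H$ if, with $A,B,C,D$ their associated $\pm1$-matrices and $\mathbf 1$ the all-ones row vector of length $2k$, the matrix \[ H=\begin{bmatrix} 1& 1 & 1 & 1 & \mathbf{1} & \mathbf{1} & \mathbf{1} & \mathbf{1}\\ 1& 1 & -1 & -1 & \mathbf{1} & \mathbf{1} & -\mathbf{1} & -\mathbf{1}\\ 1& -1 & 1 & -1 & \mathbf{1} & -\mathbf{1} & \mathbf{1} & -\mathbf{1}\\ 1&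 -1 & -1 & 1 & -\mathbf{1} & \mathbf{1} & \mathbf{1} & -\mathbf{1}\\ \mathbf{1}^\intercal & \mathbf{1}^\intercal & \mathbf{1}^\intercal & -\mathbf{1}^\intercal & A & B& C & D\\ \mathbf{1}^\intercal & \mathbf{1}^\intercal& -\mathbf{1}^\intercal & \mathbf{1}^\intercal & -B & A & D & -C\\ \mathbf{1}^\intercal & -\mathbf{1}^\intercal& \mathbf{1}^\intercal & \mathbf{1}^\intercal & -C & -D & A & B\\ \mathbf{1}^\intercal & -\mathbf{1}^\intercal& -\mathbf{1}^\intercal & -\mathbf{1}^\intercal & D & -C & B & -A \end{bmatrix} \] satisfies $HH^\intercal=(8k+4)I_{8k+4}$. -}

module Defs where

open import Data.Nat as ℕ using (ℕ; zero; suc; NonZero; _%_)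
open import Data.Nat.DivMod using (m%n<n)
open import Data.Fin using (Fin; zero; suc; toℕ; fromℕ<)
open import Data.Fin.Properties renaming (_≟_ to _≟F_)
open import Data.Bool using (Bool; true; false; _xor_; if_then_else_)
open import Data.Bool.Properties renaming (_≟_ to _≟B_)
open import Data.Integer as ℤ using (ℤ; +_; -_; _+_; _-_; _*_)
open import Data.Product using (_×_; _,_)
open import Data.Sum using (_⊎_; inj₁; inj₂)
import Data.Product.Properties as PP
import Data.Sum.Properties as SP
open import Relation.Binary.PropositionalEquality using (_≡_)
open import Relation.Nullary.Decidable using (does)
open import Relation.Binary.Definitions using (DecidableEquality)

-- The dihedral group D_{2k}.  The element (i , false) is x^i and the
-- element (i , true) is x^i y, for i : Fin k (exponent taken mod k).

D : ℕ → Set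
D k = Fin k × Bool

_≟D_ : ∀ {k} → DecidableEquality (D k)
_≟D_ = PP.≡-dec _≟F_ _≟B_

addMod : (k : ℕ) .{{_ : NonZero k}} → Fin k → Fin k → Fin k
addMod k i j = fromℕ< (m%n<n (toℕ i ℕ.+ toℕ j) k)

negMod : (k : ℕ) .{{_ : NonZero k}} → Fin k → Fin k
negMod k i = fromℕ< (m%n<n (k ℕ.∸ toℕ i) k)

-- group multiplication: (x^i y^e)(x^j y^f) = x^(i + (-1)^e j) y^(e+f),
-- using y x^j = x^(-j) y.
mulD : (k : ℕ) .{{_ : NonZero k}} → D k → D k → D k
mulD k (i , e) (j , f) =
  addMod k i (if e then negMod k j else j) , (e xor f)

sumFin : (n : ℕ) → (Fin n → ℤ) → ℤ
sumFin zero    f = + 0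
sumFin (suc n) f = f zero + sumFin n (λ i → f (suc i))

sumD : (k : ℕ) → (D k → ℤ) → ℤ
sumD k f = sumFin k (λ i → f (i , false) + f (i , true))

countFin : (n : ℕ) → (Fin n → Bool) → ℕ
countFin zero    f = 0
countFin (suc n) f = (if f zero then 1 else 0) ℕ.+ countFin n (λ i → f (suc i))

-- Elements of ℤD_{2k} with {0,1} coefficients: the coefficient of g is
-- 1 iff w g = true.

ZD01 : ℕ → Set
ZD01 k = D k → Bool

coef : Bool → ℤ
coef true  = + 1
coef false = + 0

δ : ∀ {k} → D k → D k → ℤ
δ u v = if does (u ≟D v) then + 1 else + 0

ρ : (k : ℕ) .{{_ : NonZero k}} → ZD01 k → D k → D k → ℤ
ρ k w u v = sumD k (λ g → coef (w g) * δ (mulD k u g) v)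

pm : (k : ℕ) .{{_ : NonZero k}} → ZD01 k → D k → D k → ℤ
pm k w u v = + 2 * ρ k w u v - + 1

-- w = w₁ + w₂ y, |w₁| and |w₂|
supp₁ : (k : ℕ) → ZD01 k → ℕ
supp₁ k w = countFin k (λ i → w (i , false))

supp₂ : (k : ℕ) → ZD01 k → ℕ
supp₂ k w = countFin k (λ i → w (i , true))

-- The Kimura matrix.  Rows/columns are indexed by
--   inj₁ r        (r : Fin 4)  : the first four rows/columns,
--   inj₂ (r , u)  (r : Fin 4, u : D k) : row u of the r-th block row.

Idx : ℕ → Set
Idx k = Fin 4 ⊎ (Fin 4 × D k)

_≟I_ : ∀ {k} → DecidableEquality (Idx k)
_≟I_ = SP.≡-dec _≟F_ (PP.≡-dec _≟F_ _≟D_)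

p m : ℤ
p = + 1
m = - + 1

TL : Fin 4 → Fin 4 → ℤ
TL zero          zero                = p
TL zero          (suc zero)          = p
TL zero          (suc (suc zero))    = p
TL zero          (suc (suc (suc _))) = p
TL (suc zero)    zero                = p
TL (suc zero)    (suc zero)          = p
TL (suc zero)    (suc (suc zero))    = m
TL (suc zero)    (suc (suc (suc _))) = m
TL (suc (suc zero)) zero                = p
TL (suc (suc zero)) (suc zero)          = m
TL (suc (suc zero)) (suc (suc zero))    = p
TL (suc (suc zero)) (suc (suc (suc _))) = m
TL (suc (suc (suc _))) zero                = p
TL (suc (suc (suc _))) (suc zero)          = m
TL (suc (suc (suc _))) (suc (suc zero))    = m
TL (suc (suc (suc _))) (suc (suc (suc _))) = p

-- sign of the all-ones row vector in block (r , c) of the top-right part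
TR : Fin 4 → Fin 4 → ℤ
TR zero          zero                = p
TR zero          (suc zero)          = p
TR zero          (suc (suc zero))    = p
TR zero          (suc (suc (suc _))) = p
TR (suc zero)    zero                = p
TR (suc zero)    (suc zero)          = p
TR (suc zero)    (suc (suc zero))    = m
TR (suc zero)    (suc (suc (suc _))) = m
TR (suc (suc zero)) zero                = p
TR (suc (suc zero)) (suc zero)          = m
TR (suc (suc zero)) (suc (suc zero))    = p
TR (suc (suc zero)) (suc (suc (suc _))) = m
TR (suc (suc (suc _))) zero                = m
TR (suc (suc (suc _))) (suc zero)          = p
TR (suc (suc (suc _))) (suc (suc zero))    = p
TR (suc (suc (suc _))) (suc (suc (suc _))) = m

-- sign of the all-ones column vector in block (r , c) of the bottom-left part
BL : Fin 4 → Fin 4 → ℤ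
BL zero          zero                = p
BL zero          (suc zero)          = p
BL zero          (suc (suc zero))    = p
BL zero          (suc (suc (suc _))) = m
BL (suc zero)    zero                = p
BL (suc zero)    (suc zero)          = p
BL (suc zero)    (suc (suc zero))    = m
BL (suc zero)    (suc (suc (suc _))) = p
BL (suc (suc zero)) zero                = p
BL (suc (suc zero)) (suc zero)          = m
BL (suc (suc zero)) (suc (suc zero))    = p
BL (suc (suc zero)) (suc (suc (suc _))) = p
BL (suc (suc (suc _))) zero                = p
BL (suc (suc (suc _))) (suc zero)          = m
BL (suc (suc (suc _))) (suc (suc zero))    = m
BL (suc (suc (suc _))) (suc (suc (suc _))) = m

BR : ∀ {A : Set} → (a b c d : A → A → ℤ) → Fin 4 → Fin 4 → A → A → ℤ
BR a b c d zero          zero                u v = a u v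
BR a b c d zero          (suc zero)          u v = b u v
BR a b c d zero          (suc (suc zero))    u v = c u v
BR a b c d zero          (suc (suc (suc _))) u v = d u v
BR a b c d (suc zero)    zero                u v = - b u v
BR a b c d (suc zero)    (suc zero)          u v = a u v
BR a b c d (suc zero)    (suc (suc zero))    u v = d u v
BR a b c d (suc zero)    (suc (suc (suc _))) u v = - c u v
BR a b c d (suc (suc zero)) zero                u v = - c u v
BR a b c d (suc (suc zero)) (suc zero)          u v = - d u v
BR a b c d (suc (suc zero)) (suc (suc zero))    u v = a u v
BR a b c d (suc (suc zero)) (suc (suc (suc _))) u v = b u v
BR a b c d (suc (suc (suc _))) zero                u v = d u v
BR a b c d (suc (suc (suc _))) (suc zero)          u v = - c u v
BR a b c d (suc (suc (suc _))) (suc (suc zero))    u v = b u v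
BR a b c d (suc (suc (suc _))) (suc (suc (suc _))) u v = - a u v

kimuraH : (k : ℕ) .{{_ : NonZero k}} → (a b c d : ZD01 k) → Idx k → Idx k → ℤ
kimuraH k a b c d (inj₁ r)       (inj₁ s)       = TL r s
kimuraH k a b c d (inj₁ r)       (inj₂ (s , v)) = TR r s
kimuraH k a b c d (inj₂ (r , u)) (inj₁ s)       = BL r s
kimuraH k a b c d (inj₂ (r , u)) (inj₂ (s , v)) =
  BR (pm k a) (pm k b) (pm k c) (pm k d) r s u v

sumIdx : (k : ℕ) → (Idx k → ℤ) → ℤ
sumIdx k f = sumFin 4 (λ r → f (inj₁ r)) + sumFin 4 (λ r → sumD k (λ u → f (inj₂ (r , u))))

YieldKimura : (k : ℕ) .{{_ : NonZero k}} → (a b c d : ZD01 k) → Set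
YieldKimura k a b c d =
  ∀ (r s : Idx k) →
    sumIdx k (λ t → kimuraH k a b c d r t * kimuraH k a b c d s t)
      ≡ (if does (r ≟I s) then + (8 ℕ.* k ℕ.+ 4) else + 0)

module Submission where

-- Orthogonality of the four border rows of H to a row of the first block row gives a linear
-- system for the weights |w| = |w₁| + |w₂|, whose matrix is the border block TR; as TR is a
-- Hadamard matrix it inverts to |a| = k − 1 and |b| = |c| = |d| = k. Next let χ be the sign
-- character of D_{2k} (x ↦ 1, y ↦ −1), so χ(w) = |w₁| − |w₂|. The χ-weighted sum z of the rows
-- of the first block row has ‖z‖² = 2k(8k+4) by HHᵀ = (8k+4)I, and its entries are 0 on the
-- border and ±2χ(w) on the block of w; hence χ(a)² + χ(b)² + χ(c)² + χ(d)² = 2k + 1. If one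
-- half of w were all of w, then χ(w)² = |w|² > 2k + 1, as |w| ≥ k − 1 ≥ 4.

open import Defs
import Algebra.Properties.Semiring.Sum as SemiringSum
import Algebra.Properties.CommutativeSemigroup as CommutativeSemigroupProperties
open import Data.Nat as ℕ using (ℕ; zero; suc; NonZero; _≤_; _<_; _∸_; s≤s; z<s)
import Data.Nat.Properties as ℕP
open import Data.Nat.DivMod using (_%_; m%n<n; %-distribˡ-+; m%n%n≡m%n; [m+n]%n≡m%n; m<n⇒m%n≡m)
import Data.Nat.Tactic.RingSolver as ℕSolver
open import Data.Fin using (Fin; zero; suc; toℕ; fromℕ<; punchIn)
import Data.Fin.Properties as FinP
open import Data.Empty using (⊥-elim)
open import Data.Bool using (Bool; true; false; _xor_; if_then_else_)
open import Data.Product using (_×_; _,_; proj₁; ∃)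
open import Data.Sum using (_⊎_; inj₁; inj₂)
open import Function using (_∘_)
open import Relation.Binary.PropositionalEquality
open import Relation.Nullary using (does)
open import Relation.Nullary.Decidable using (dec-true; dec-false; toWitness)

-- ℤ's operators are opened only inside this module, leaving _+_ and _*_ to ℕ in the theorem.
module _ where

  open import Data.Integer as ℤ using (ℤ; +_; -[1+_]; -_; _+_; _-_; _*_; 0ℤ; 1ℤ; -1ℤ)
  import Data.Integer.Properties as ℤP
  open import Data.Integer.Tactic.RingSolver using (solve-∀)
  open CommutativeSemigroupProperties ℤP.+-commutativeSemigroup
    using () renaming (interchange to +-interchange)
  open CommutativeSemigroupProperties ℤP.*-commutativeSemigroup
    using () renaming (interchange to *-interchange; x∙yz≈y∙xz to x*yz≡y*xz; x∙yz≈y∙zx to x*yz≡y*zx)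
  module ∑ℤ = SemiringSum ℤP.+-*-semiring

  record IsSummation {A : Set} (∑ : (A → ℤ) → ℤ) : Set where
    field
      ∑-cong       : ∀ {f g} → f ≗ g → ∑ f ≡ ∑ g
      ∑-distrib-+  : ∀ f g → ∑ (λ x → f x + g x) ≡ ∑ f + ∑ g
      *-distribˡ-∑ : ∀ c f → c * ∑ f ≡ ∑ (λ x → c * f x)

    *-distribʳ-∑ : ∀ c f → ∑ f * c ≡ ∑ (λ x → f x * c)
    *-distribʳ-∑ c f = trans (ℤP.*-comm (∑ f) c)
      (trans (*-distribˡ-∑ c f) (∑-cong λ x → ℤP.*-comm c (f x)))

    ∑-zero : ∑ (λ _ → 0ℤ) ≡ 0ℤ
    ∑-zero = trans (sym (*-distribˡ-∑ 0ℤ (λ _ → 0ℤ))) (ℤP.*-zeroˡ (∑ (λ _ → 0ℤ)))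

    ∑-distrib-minus : ∀ f g → ∑ (λ x → f x - g x) ≡ ∑ f - ∑ g
    ∑-distrib-minus f g = begin
      ∑ (λ x → f x - g x)          ≡⟨ ∑-distrib-+ f (λ x → - g x) ⟩
      ∑ f + ∑ (λ x → - g x)        ≡⟨ cong (_+_ (∑ f)) (∑-cong λ x → sym (ℤP.-1*i≡-i (g x))) ⟩
      ∑ f + ∑ (λ x → -1ℤ * g x)    ≡⟨ cong (_+_ (∑ f)) (sym (*-distribˡ-∑ -1ℤ g)) ⟩
      ∑ f + -1ℤ * ∑ g              ≡⟨ cong (_+_ (∑ f)) (ℤP.-1*i≡-i (∑ g)) ⟩
      ∑ f - ∑ g                    ∎
      where open ≡-Reasoning

    ∑-square : ∀ f → ∑ f * ∑ f ≡ ∑ (λ x → ∑ (λ y → f x * f y))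
    ∑-square f = trans (*-distribʳ-∑ (∑ f) f) (∑-cong λ x → *-distribˡ-∑ (f x) f)

  open IsSummation

  IsSummation-≗ : ∀ {A} {S T : (A → ℤ) → ℤ} → (∀ f → S f ≡ T f) → IsSummation S → IsSummation T
  IsSummation-≗ {S = S} {T} S≗T isS = record
    { ∑-cong       = λ {f} {g} f≗g → trans (sym (S≗T f)) (trans (∑-cong isS f≗g) (S≗T g))
    ; ∑-distrib-+  = λ f g → trans (sym (S≗T _))
                                   (trans (∑-distrib-+ isS f g) (cong₂ _+_ (S≗T f) (S≗T g)))
    ; *-distribˡ-∑ = λ c f → trans (cong (c *_) (sym (S≗T f))) (trans (*-distribˡ-∑ isS c f) (S≗T _))
    }

  sum-isSummation : ∀ {n} → IsSummation (∑ℤ.sum {n})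
  sum-isSummation = record
    { ∑-cong       = ∑ℤ.sum-cong-≗
    ; ∑-distrib-+  = ∑ℤ.∑-distrib-+
    ; *-distribˡ-∑ = ∑ℤ.*-distribˡ-sum
    }

  sumFin≡sum : ∀ n (f : Fin n → ℤ) → sumFin n f ≡ ∑ℤ.sum f
  sumFin≡sum zero    f = refl
  sumFin≡sum (suc n) f = cong (_+_ (f zero)) (sumFin≡sum n (f ∘ suc))

  sumFin-isSummation : ∀ n → IsSummation (sumFin n)
  sumFin-isSummation n = IsSummation-≗ (sym ∘ sumFin≡sum n) sum-isSummation

  sumBool-isSummation : IsSummation (λ (f : Bool → ℤ) → f false + f true)
  sumBool-isSummation = record
    { ∑-cong       = λ f≗g → cong₂ _+_ (f≗g false) (f≗g true)
    ; ∑-distrib-+  = λ f g → +-interchange (f false) (g false) (f true) (g true)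
    ; *-distribˡ-∑ = λ c f → ℤP.*-distribˡ-+ c (f false) (f true)
    }

  ×-isSummation : ∀ {A B} {S : (A → ℤ) → ℤ} {T : (B → ℤ) → ℤ} → IsSummation S → IsSummation T →
    IsSummation (λ (f : A × B → ℤ) → S (λ a → T (λ b → f (a , b))))
  ×-isSummation isS isT = record
    { ∑-cong       = λ f≗g → ∑-cong isS λ a → ∑-cong isT λ b → f≗g (a , b)
    ; ∑-distrib-+  = λ f g → trans (∑-cong isS λ a → ∑-distrib-+ isT _ _) (∑-distrib-+ isS _ _)
    ; *-distribˡ-∑ = λ c f → trans (*-distribˡ-∑ isS c _) (∑-cong isS λ a → *-distribˡ-∑ isT c _)
    }

  ⊎-isSummation : ∀ {A B} {S : (A → ℤ) → ℤ} {T : (B → ℤ) → ℤ} → IsSummation S → IsSummation T →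
    IsSummation (λ (f : A ⊎ B → ℤ) → S (f ∘ inj₁) + T (f ∘ inj₂))
  ⊎-isSummation {S = S} {T} isS isT = record
    { ∑-cong       = λ f≗g → cong₂ _+_ (∑-cong isS (f≗g ∘ inj₁)) (∑-cong isT (f≗g ∘ inj₂))
    ; ∑-distrib-+  = λ f g → trans (cong₂ _+_ (∑-distrib-+ isS (f ∘ inj₁) (g ∘ inj₁))
                                              (∑-distrib-+ isT (f ∘ inj₂) (g ∘ inj₂)))
                                   (+-interchange (S (f ∘ inj₁)) (S (g ∘ inj₁)) (T (f ∘ inj₂)) (T (g ∘ inj₂)))
    ; *-distribˡ-∑ = λ c f → trans (ℤP.*-distribˡ-+ c _ _)
                                   (cong₂ _+_ (*-distribˡ-∑ isS c _) (*-distribˡ-∑ isT c _))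
    }

  sumD-isSummation : ∀ k → IsSummation (sumD k)
  sumD-isSummation k = ×-isSummation (sumFin-isSummation k) sumBool-isSummation

  sumIdx-isSummation : ∀ k → IsSummation (sumIdx k)
  sumIdx-isSummation k =
    ⊎-isSummation (sumFin-isSummation 4) (×-isSummation (sumFin-isSummation 4) (sumD-isSummation k))

  module ∑Fin₄ = IsSummation (sumFin-isSummation 4)

  sumFin-comm : ∀ {B} {T : (B → ℤ) → ℤ} → IsSummation T → ∀ n (f : Fin n → B → ℤ) →
    sumFin n (λ i → T (f i)) ≡ T (λ y → sumFin n (λ i → f i y))
  sumFin-comm isT zero    f = sym (∑-zero isT)
  sumFin-comm {T = T} isT (suc n) f =
    trans (cong (_+_ (T (f zero))) (sumFin-comm isT n (f ∘ suc))) (sym (∑-distrib-+ isT (f zero) _))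

  sumD-comm : ∀ {B} {T : (B → ℤ) → ℤ} → IsSummation T → ∀ k (f : D k → B → ℤ) →
    sumD k (λ u → T (f u)) ≡ T (λ y → sumD k (λ u → f u y))
  sumD-comm isT k f =
    trans (∑-cong (sumFin-isSummation k) λ i → sym (∑-distrib-+ isT (f (i , false)) (f (i , true))))
          (sumFin-comm isT k _)

  sumFin-single : ∀ {n} (f : Fin n → ℤ) i → (∀ j → j ≢ i → f j ≡ 0ℤ) → sumFin n f ≡ f i
  sumFin-single {suc n} f i vanishes = begin
    sumFin (suc n) f                  ≡⟨ sumFin≡sum (suc n) f ⟩
    ∑ℤ.sum f                          ≡⟨ ∑ℤ.sum-remove {i = i} f ⟩
    f i + ∑ℤ.sum (f ∘ punchIn i)
      ≡⟨ cong (_+_ (f i)) (∑ℤ.sum-cong-≗ {n} λ j → vanishes (punchIn i j) (FinP.punchInᵢ≢i i j)) ⟩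
    f i + ∑ℤ.sum {n} (λ _ → 0ℤ)       ≡⟨ cong (_+_ (f i)) (∑ℤ.sum-replicate-zero n) ⟩
    f i + 0ℤ                          ≡⟨ ℤP.+-identityʳ (f i) ⟩
    f i                               ∎
    where open ≡-Reasoning

  sumD-single : ∀ {k} (f : D k → ℤ) x → (∀ y → y ≢ x → f y ≡ 0ℤ) → sumD k f ≡ f x
  sumD-single {k} f (i , e) vanishes =
    trans (sumFin-single {k} _ i λ j j≢i →
             cong₂ _+_ (vanishes _ (j≢i ∘ cong proj₁)) (vanishes _ (j≢i ∘ cong proj₁)))
          (fibre e vanishes)
    where
    fibre : ∀ e → (∀ y → y ≢ (i , e) → f y ≡ 0ℤ) → f (i , false) + f (i , true) ≡ f (i , e)
    fibre false vanishes = trans (cong (_+_ (f (i , false))) (vanishes (i , true) λ ())) (ℤP.+-identityʳ _)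
    fibre true  vanishes = trans (cong (_+ f (i , true)) (vanishes (i , false) λ ())) (ℤP.+-identityˡ _)

  sumFin-const : ∀ n c → sumFin n (λ _ → c) ≡ + n * c
  sumFin-const zero    c = sym (ℤP.*-zeroˡ c)
  sumFin-const (suc n) c = trans (cong (_+_ c) (sumFin-const n c)) (sym (ℤP.suc-* (+ n) c))

  sumD-const : ∀ k c → sumD k (λ _ → c) ≡ + k * (c + c)
  sumD-const k c = sumFin-const k (c + c)

  sumFin-coef : ∀ n (p : Fin n → Bool) → sumFin n (coef ∘ p) ≡ + countFin n p
  sumFin-coef zero    p = refl
  sumFin-coef (suc n) p with p zero
  ... | true  = cong (_+_ 1ℤ) (sumFin-coef n (p ∘ suc))
  ... | false = trans (ℤP.+-identityˡ _) (sumFin-coef n (p ∘ suc))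

  sumFin-nonneg : ∀ n (f : Fin n → ℤ) → (∀ j → 0ℤ ℤ.≤ f j) → 0ℤ ℤ.≤ sumFin n f
  sumFin-nonneg zero    f nonneg = ℤP.≤-refl
  sumFin-nonneg (suc n) f nonneg =
    ℤP.+-mono-≤ (nonneg zero) (sumFin-nonneg n (f ∘ suc) (nonneg ∘ suc))

  ≤-sumFin : ∀ n (f : Fin n → ℤ) → (∀ j → 0ℤ ℤ.≤ f j) → ∀ i → f i ℤ.≤ sumFin n f
  ≤-sumFin (suc n) f nonneg zero    = ℤP.≤-trans (ℤP.≤-reflexive (sym (ℤP.+-identityʳ (f zero))))
    (ℤP.+-monoʳ-≤ (f zero) (sumFin-nonneg n (f ∘ suc) (nonneg ∘ suc)))
  ≤-sumFin (suc n) f nonneg (suc i) = ℤP.≤-trans (≤-sumFin n (f ∘ suc) (nonneg ∘ suc) i)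
    (ℤP.≤-trans (ℤP.≤-reflexive (sym (ℤP.+-identityˡ _)))
                (ℤP.+-monoˡ-≤ (sumFin n (f ∘ suc)) (nonneg zero)))

  square-nonneg : ∀ x → 0ℤ ℤ.≤ x * x
  square-nonneg (+ n)     = subst (0ℤ ℤ.≤_) (ℤP.pos-* n n) (ℤ.+≤+ ℕ.z≤n)
  square-nonneg -[1+ n ]  = ℤ.+≤+ ℕ.z≤n

  left<whole : ∀ s₁ s₂ {x} → s₁ ℕ.+ s₂ ≡ x →
    (+ s₁ - + s₂) * (+ s₁ - + s₂) ℤ.< + (x ℕ.* x) → s₁ < x
  left<whole s₁ (suc s₂) refl _     = ℕP.m<m+n s₁ z<s
  left<whole s₁ zero     refl s²<s² =
    ⊥-elim (ℤP.<-irrefl (sym (ℤP.pos-* (s₁ ℕ.+ 0) (s₁ ℕ.+ 0))) s²<s²)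

  halves<whole : ∀ s₁ s₂ {x} → s₁ ℕ.+ s₂ ≡ x →
    (+ s₁ - + s₂) * (+ s₁ - + s₂) ℤ.< + (x ℕ.* x) → s₁ < x × s₂ < x
  halves<whole s₁ s₂ s₁+s₂≡x lt =
      left<whole s₁ s₂ s₁+s₂≡x lt
    , left<whole s₂ s₁ (trans (ℕP.+-comm s₂ s₁) s₁+s₂≡x)
                 (subst (ℤ._< _) (square-swap (+ s₁) (+ s₂)) lt)
    where
    square-swap : ∀ x y → (x - y) * (x - y) ≡ (y - x) * (y - x)
    square-swap = solve-∀

  2k+1<[k∸1]² : ∀ {k} → 5 ≤ k → 2 ℕ.* k ℕ.+ 1 < (k ∸ 1) ℕ.* (k ∸ 1)
  2k+1<[k∸1]² (s≤s (s≤s (s≤s (s≤s (s≤s {n = n} _))))) =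
    subst (2 ℕ.* (5 ℕ.+ n) ℕ.+ 1 <_) (sym (expand n)) (ℕP.m<m+n _ z<s)
    where
    expand : ∀ n →
      (4 ℕ.+ n) ℕ.* (4 ℕ.+ n) ≡ 2 ℕ.* (5 ℕ.+ n) ℕ.+ 1 ℕ.+ suc (4 ℕ.+ 6 ℕ.* n ℕ.+ n ℕ.* n)
    expand = ℕSolver.solve-∀

  2k+1<k² : ∀ {k} → 5 ≤ k → 2 ℕ.* k ℕ.+ 1 < k ℕ.* k
  2k+1<k² {k} 5≤k =
    ℕP.<-≤-trans (2k+1<[k∸1]² 5≤k) (ℕP.*-mono-≤ (ℕP.m∸n≤m k 1) (ℕP.m∸n≤m k 1))

  8t+4·2[W-K]≡0⇒W≡K-t : ∀ W K t → + 8 * t + + 4 * (+ 2 * (W - K)) ≡ 0ℤ → W ≡ K - t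
  8t+4·2[W-K]≡0⇒W≡K-t W K t h = ℤP.*-cancelˡ-≡ (+ 8) W (K - t) (begin
    + 8 * W                                               ≡⟨ regroup W K t ⟩
    + 8 * t + + 4 * (+ 2 * (W - K)) + + 8 * (K - t)       ≡⟨ cong (_+ + 8 * (K - t)) h ⟩
    0ℤ + + 8 * (K - t)                                    ≡⟨ ℤP.+-identityˡ _ ⟩
    + 8 * (K - t)                                         ∎)
    where
    open ≡-Reasoning
    regroup : ∀ W K t → + 8 * W ≡ + 8 * t + + 4 * (+ 2 * (W - K)) + + 8 * (K - t)
    regroup = solve-∀

  module _ (k : ℕ) .{{_ : NonZero k}} where

    subMod : Fin k → Fin k → Fin k
    subMod i j = fromℕ< (m%n<n (toℕ i ℕ.+ (k ∸ toℕ j)) k)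

    %-shift : ∀ x p q → p ℕ.+ q ≡ k → ((x ℕ.+ p) % k ℕ.+ q) % k ≡ x % k
    %-shift x p q p+q≡k = begin
      ((x ℕ.+ p) % k ℕ.+ q) % k          ≡⟨ %-distribˡ-+ ((x ℕ.+ p) % k) q k ⟩
      ((x ℕ.+ p) % k % k ℕ.+ q % k) % k  ≡⟨ cong (λ m → (m ℕ.+ q % k) % k) (m%n%n≡m%n (x ℕ.+ p) k) ⟩
      ((x ℕ.+ p) % k ℕ.+ q % k) % k      ≡⟨ %-distribˡ-+ (x ℕ.+ p) q k ⟨
      (x ℕ.+ p ℕ.+ q) % k                ≡⟨ cong (_% k) (ℕP.+-assoc x p q) ⟩
      (x ℕ.+ (p ℕ.+ q)) % k              ≡⟨ cong (λ m → (x ℕ.+ m) % k) p+q≡k ⟩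
      (x ℕ.+ k) % k                      ≡⟨ [m+n]%n≡m%n x k ⟩
      x % k                              ∎
      where open ≡-Reasoning

    addMod-subMod : ∀ i j → addMod k (subMod i j) j ≡ i
    addMod-subMod i j = FinP.toℕ-injective (begin
      toℕ (addMod k (subMod i j) j)
        ≡⟨ FinP.toℕ-fromℕ< _ ⟩
      (toℕ (subMod i j) ℕ.+ toℕ j) % k
        ≡⟨ cong (λ m → (m ℕ.+ toℕ j) % k) (FinP.toℕ-fromℕ< _) ⟩
      ((toℕ i ℕ.+ (k ∸ toℕ j)) % k ℕ.+ toℕ j) % k
        ≡⟨ %-shift (toℕ i) _ _ (ℕP.m∸n+n≡m (ℕP.<⇒≤ (FinP.toℕ<n j))) ⟩
      toℕ i % k
        ≡⟨ m<n⇒m%n≡m (FinP.toℕ<n i) ⟩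
      toℕ i
        ∎)
      where open ≡-Reasoning

    subMod-addMod : ∀ i j → subMod (addMod k i j) j ≡ i
    subMod-addMod i j = FinP.toℕ-injective (begin
      toℕ (subMod (addMod k i j) j)
        ≡⟨ FinP.toℕ-fromℕ< _ ⟩
      (toℕ (addMod k i j) ℕ.+ (k ∸ toℕ j)) % k
        ≡⟨ cong (λ m → (m ℕ.+ (k ∸ toℕ j)) % k) (FinP.toℕ-fromℕ< _) ⟩
      ((toℕ i ℕ.+ toℕ j) % k ℕ.+ (k ∸ toℕ j)) % k
        ≡⟨ %-shift (toℕ i) _ _ (ℕP.m+[n∸m]≡n (ℕP.<⇒≤ (FinP.toℕ<n j))) ⟩
      toℕ i % k
        ≡⟨ m<n⇒m%n≡m (FinP.toℕ<n i) ⟩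
      toℕ i
        ∎)
      where open ≡-Reasoning

    divʳ : D k → D k → D k
    divʳ (t , e) (j , f) = subMod t (if e xor f then negMod k j else j) , e xor f

    mulD-divʳ : ∀ v g → mulD k (divʳ v g) g ≡ v
    mulD-divʳ (t , false) (j , false) = cong (_, false) (addMod-subMod t _)
    mulD-divʳ (t , false) (j , true)  = cong (_, false) (addMod-subMod t _)
    mulD-divʳ (t , true)  (j , false) = cong (_, true)  (addMod-subMod t _)
    mulD-divʳ (t , true)  (j , true)  = cong (_, true)  (addMod-subMod t _)

    mulD≡⇒≡divʳ : ∀ u g {v} → mulD k u g ≡ v → u ≡ divʳ v g
    mulD≡⇒≡divʳ (i , false) (j , false) refl = cong (_, false) (sym (subMod-addMod i _))
    mulD≡⇒≡divʳ (i , false) (j , true)  refl = cong (_, false) (sym (subMod-addMod i _))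
    mulD≡⇒≡divʳ (i , true)  (j , false) refl = cong (_, true)  (sym (subMod-addMod i _))
    mulD≡⇒≡divʳ (i , true)  (j , true)  refl = cong (_, true)  (sym (subMod-addMod i _))

  χ : ∀ {k} → D k → ℤ
  χ (_ , false) = 1ℤ
  χ (_ , true)  = -1ℤ

  χ*χ≡1 : ∀ {k} (u : D k) → χ u * χ u ≡ 1ℤ
  χ*χ≡1 (_ , false) = refl
  χ*χ≡1 (_ , true)  = refl

  sumD-χ : ∀ k → sumD k χ ≡ 0ℤ
  sumD-χ k = ∑-zero (sumFin-isSummation k)

  δ-diag : ∀ {k} (v : D k) → δ v v ≡ 1ℤ
  δ-diag v rewrite dec-true (v ≟D v) refl = refl

  δ-off : ∀ {k} {u v : D k} → u ≢ v → δ u v ≡ 0ℤ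
  δ-off {u = u} {v} u≢v rewrite dec-false (u ≟D v) u≢v = refl

  module _ (k : ℕ) .{{_ : NonZero k}} where

    private
      module ∑Fin = IsSummation (sumFin-isSummation k)
      module ∑D = IsSummation (sumD-isSummation k)

    χ-divʳ : ∀ v g → χ (divʳ k v g) ≡ χ v * χ g
    χ-divʳ (t , false) (j , false) = refl
    χ-divʳ (t , false) (j , true)  = refl
    χ-divʳ (t , true)  (j , false) = refl
    χ-divʳ (t , true)  (j , true)  = refl

    sumD-δ : ∀ x → sumD k (δ x) ≡ 1ℤ
    sumD-δ x = trans (sumD-single (δ x) x λ y y≢x → δ-off (y≢x ∘ sym)) (δ-diag x)

    sumD-χ-δ-mulD : ∀ g v → sumD k (λ u → χ u * δ (mulD k u g) v) ≡ χ v * χ g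
    sumD-χ-δ-mulD g v = begin
      sumD k (λ u → χ u * δ (mulD k u g) v)         ≡⟨ sumD-single _ (divʳ k v g) off-divʳ ⟩
      χ (divʳ k v g) * δ (mulD k (divʳ k v g) g) v
        ≡⟨ cong (λ x → χ (divʳ k v g) * δ x v) (mulD-divʳ k v g) ⟩
      χ (divʳ k v g) * δ v v                        ≡⟨ cong₂ _*_ (χ-divʳ v g) (δ-diag v) ⟩
      χ v * χ g * 1ℤ                                ≡⟨ ℤP.*-identityʳ _ ⟩
      χ v * χ g                                     ∎
      where
      open ≡-Reasoning
      off-divʳ : ∀ u → u ≢ divʳ k v g → χ u * δ (mulD k u g) v ≡ 0ℤ
      off-divʳ u u≢ = trans (cong (χ u *_) (δ-off (u≢ ∘ mulD≡⇒≡divʳ k u g))) (ℤP.*-zeroʳ (χ u))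

    weight : ZD01 k → ℤ
    weight w = sumD k (coef ∘ w)

    signedWeight : ZD01 k → ℤ
    signedWeight w = sumD k (λ g → χ g * coef (w g))

    ρ-rowSum : ∀ w u → sumD k (ρ k w u) ≡ weight w
    ρ-rowSum w u = begin
      sumD k (λ v → sumD k (λ g → coef (w g) * δ (mulD k u g) v))
        ≡⟨ sumD-comm (sumD-isSummation k) k (λ v g → coef (w g) * δ (mulD k u g) v) ⟩
      sumD k (λ g → sumD k (λ v → coef (w g) * δ (mulD k u g) v))
        ≡⟨ ∑D.∑-cong (λ g → sym (∑D.*-distribˡ-∑ (coef (w g)) (δ (mulD k u g)))) ⟩
      sumD k (λ g → coef (w g) * sumD k (δ (mulD k u g)))
        ≡⟨ ∑D.∑-cong (λ g → cong (coef (w g) *_) (sumD-δ (mulD k u g))) ⟩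
      sumD k (λ g → coef (w g) * 1ℤ)
        ≡⟨ ∑D.∑-cong (λ g → ℤP.*-identityʳ (coef (w g))) ⟩
      weight w
        ∎
      where open ≡-Reasoning

    χ-ρ-colSum : ∀ w v → sumD k (λ u → χ u * ρ k w u v) ≡ χ v * signedWeight w
    χ-ρ-colSum w v = begin
      sumD k (λ u → χ u * sumD k (λ g → coef (w g) * δ (mulD k u g) v))
        ≡⟨ ∑D.∑-cong (λ u → trans (∑D.*-distribˡ-∑ (χ u) (λ g → coef (w g) * δ (mulD k u g) v))
                                    (∑D.∑-cong λ g → x*yz≡y*xz (χ u) (coef (w g)) (δ (mulD k u g) v))) ⟩
      sumD k (λ u → sumD k (λ g → coef (w g) * (χ u * δ (mulD k u g) v)))
        ≡⟨ sumD-comm (sumD-isSummation k) k (λ u g → coef (w g) * (χ u * δ (mulD k u g) v)) ⟩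
      sumD k (λ g → sumD k (λ u → coef (w g) * (χ u * δ (mulD k u g) v)))
        ≡⟨ ∑D.∑-cong (λ g → sym (∑D.*-distribˡ-∑ (coef (w g)) (λ u → χ u * δ (mulD k u g) v))) ⟩
      sumD k (λ g → coef (w g) * sumD k (λ u → χ u * δ (mulD k u g) v))
        ≡⟨ ∑D.∑-cong (λ g → cong (coef (w g) *_) (sumD-χ-δ-mulD g v)) ⟩
      sumD k (λ g → coef (w g) * (χ v * χ g))
        ≡⟨ ∑D.∑-cong (λ g → x*yz≡y*zx (coef (w g)) (χ v) (χ g)) ⟩
      sumD k (λ g → χ v * (χ g * coef (w g)))
        ≡⟨ ∑D.*-distribˡ-∑ (χ v) (λ g → χ g * coef (w g)) ⟨
      χ v * signedWeight w
        ∎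
      where open ≡-Reasoning

    pm-rowSum : ∀ w u → sumD k (pm k w u) ≡ + 2 * (weight w - + k)
    pm-rowSum w u = begin
      sumD k (λ v → + 2 * ρ k w u v - 1ℤ)
        ≡⟨ ∑D.∑-distrib-minus (λ v → + 2 * ρ k w u v) (λ _ → 1ℤ) ⟩
      sumD k (λ v → + 2 * ρ k w u v) - sumD k (λ _ → 1ℤ)
        ≡⟨ cong₂ _-_ (trans (sym (∑D.*-distribˡ-∑ (+ 2) (ρ k w u))) (cong (_*_ (+ 2)) (ρ-rowSum w u)))
                     (sumD-const k 1ℤ) ⟩
      + 2 * weight w - + k * (1ℤ + 1ℤ)
        ≡⟨ regroup (weight w) (+ k) ⟩
      + 2 * (weight w - + k)
        ∎
      where
      open ≡-Reasoning
      regroup : ∀ W K → + 2 * W - K * (1ℤ + 1ℤ) ≡ + 2 * (W - K)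
      regroup = solve-∀

    χ-pm-colSum : ∀ w v → sumD k (λ u → χ u * pm k w u v) ≡ + 2 * (χ v * signedWeight w)
    χ-pm-colSum w v = begin
      sumD k (λ u → χ u * (+ 2 * ρ k w u v - 1ℤ))
        ≡⟨ ∑D.∑-cong (λ u → distrib (χ u) (ρ k w u v)) ⟩
      sumD k (λ u → + 2 * (χ u * ρ k w u v) - χ u)
        ≡⟨ ∑D.∑-distrib-minus (λ u → + 2 * (χ u * ρ k w u v)) χ ⟩
      sumD k (λ u → + 2 * (χ u * ρ k w u v)) - sumD k χ
        ≡⟨ cong₂ _-_ (trans (sym (∑D.*-distribˡ-∑ (+ 2) (λ u → χ u * ρ k w u v)))
                            (cong (_*_ (+ 2)) (χ-ρ-colSum w v)))
                     (sumD-χ k) ⟩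
      + 2 * (χ v * signedWeight w) - 0ℤ
        ≡⟨ ℤP.+-identityʳ _ ⟩
      + 2 * (χ v * signedWeight w)
        ∎
      where
      open ≡-Reasoning
      distrib : ∀ x r → x * (+ 2 * r - 1ℤ) ≡ + 2 * (x * r) - x
      distrib = solve-∀

    weight≡supp₁+supp₂ : ∀ w → weight w ≡ + supp₁ k w + + supp₂ k w
    weight≡supp₁+supp₂ w =
      trans (∑Fin.∑-distrib-+ (λ i → coef (w (i , false))) (λ i → coef (w (i , true))))
            (cong₂ _+_ (sumFin-coef k (λ i → w (i , false))) (sumFin-coef k (λ i → w (i , true))))

    signedWeight≡supp₁-supp₂ : ∀ w → signedWeight w ≡ + supp₁ k w - + supp₂ k w
    signedWeight≡supp₁-supp₂ w = begin
      sumFin k (λ i → 1ℤ * coef (w (i , false)) + -1ℤ * coef (w (i , true)))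
        ≡⟨ ∑Fin.∑-cong (λ i → cong₂ _+_ (ℤP.*-identityˡ (coef (w (i , false))))
                                         (ℤP.-1*i≡-i (coef (w (i , true))))) ⟩
      sumFin k (λ i → coef (w (i , false)) - coef (w (i , true)))
        ≡⟨ ∑Fin.∑-distrib-minus (λ i → coef (w (i , false))) (λ i → coef (w (i , true))) ⟩
      sumFin k (λ i → coef (w (i , false))) - sumFin k (λ i → coef (w (i , true)))
        ≡⟨ cong₂ _-_ (sumFin-coef k (λ i → w (i , false))) (sumFin-coef k (λ i → w (i , true))) ⟩
      + supp₁ k w - + supp₂ k w
        ∎
      where open ≡-Reasoning

    halves<weight : ∀ (w : ZD01 k) {x} → weight w ≡ + x →
      signedWeight w * signedWeight w ℤ.< + (x ℕ.* x) → supp₁ k w < x × supp₂ k w < x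
    halves<weight w |w|≡x sw²<x² = halves<whole (supp₁ k w) (supp₂ k w)
      (ℤP.+-injective (trans (sym (weight≡supp₁+supp₂ w)) |w|≡x))
      (subst (λ y → y * y ℤ.< _) (signedWeight≡supp₁-supp₂ w) sw²<x²)

  TR-orthogonal : ∀ r s → sumFin 4 (λ i → TR i r * TR i s) ≡ (if does (r FinP.≟ s) then + 4 else 0ℤ)
  TR-orthogonal = toWitness {a? = FinP.all? λ r → FinP.all? λ s → _ ℤ.≟ _} _

  TRᵀTR≡4 : ∀ (e : Fin 4 → ℤ) r →
    sumFin 4 (λ i → TR i r * sumFin 4 (λ s → TR i s * e s)) ≡ + 4 * e r
  TRᵀTR≡4 e r = begin
    sumFin 4 (λ i → TR i r * sumFin 4 (λ s → TR i s * e s))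
      ≡⟨ ∑Fin₄.∑-cong (λ i → ∑Fin₄.*-distribˡ-∑ (TR i r) (λ s → TR i s * e s)) ⟩
    sumFin 4 (λ i → sumFin 4 (λ s → TR i r * (TR i s * e s)))
      ≡⟨ sumFin-comm (sumFin-isSummation 4) 4 (λ i s → TR i r * (TR i s * e s)) ⟩
    sumFin 4 (λ s → sumFin 4 (λ i → TR i r * (TR i s * e s)))
      ≡⟨ ∑Fin₄.∑-cong (λ s → trans (∑Fin₄.∑-cong λ i → sym (ℤP.*-assoc (TR i r) (TR i s) (e s)))
                                   (sym (∑Fin₄.*-distribʳ-∑ (e s) (λ i → TR i r * TR i s)))) ⟩
    sumFin 4 (λ s → sumFin 4 (λ i → TR i r * TR i s) * e s)
      ≡⟨ sumFin-single _ r offDiagonal ⟩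
    sumFin 4 (λ i → TR i r * TR i r) * e r
      ≡⟨ cong (_* e r) (TR-orthogonal r r) ⟩
    (if does (r FinP.≟ r) then + 4 else 0ℤ) * e r
      ≡⟨ cong (λ x → (if x then + 4 else 0ℤ) * e r) (dec-true (r FinP.≟ r) refl) ⟩
    + 4 * e r
      ∎
    where
    open ≡-Reasoning
    offDiagonal : ∀ s → s ≢ r → sumFin 4 (λ i → TR i r * TR i s) * e s ≡ 0ℤ
    offDiagonal s s≢r = begin
      sumFin 4 (λ i → TR i r * TR i s) * e s          ≡⟨ cong (_* e s) (TR-orthogonal r s) ⟩
      (if does (r FinP.≟ s) then + 4 else 0ℤ) * e s
        ≡⟨ cong (λ x → (if x then + 4 else 0ℤ) * e s) (dec-false (r FinP.≟ s) (s≢r ∘ sym)) ⟩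
      0ℤ * e s                                        ≡⟨ ℤP.*-zeroˡ (e s) ⟩
      0ℤ                                              ∎

  TR-solve : (c e : Fin 4 → ℤ) → (∀ i → c i + sumFin 4 (λ s → TR i s * e s) ≡ 0ℤ) →
    ∀ r → sumFin 4 (λ i → TR i r * c i) + + 4 * e r ≡ 0ℤ
  TR-solve c e TRe≡-c r = begin
    sumFin 4 (λ i → TR i r * c i) + + 4 * e r
      ≡⟨ cong (_+_ (sumFin 4 (λ i → TR i r * c i))) (TRᵀTR≡4 e r) ⟨
    sumFin 4 (λ i → TR i r * c i) + sumFin 4 (λ i → TR i r * TRe i)
      ≡⟨ ∑Fin₄.∑-distrib-+ (λ i → TR i r * c i) (λ i → TR i r * TRe i) ⟨
    sumFin 4 (λ i → TR i r * c i + TR i r * TRe i)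
      ≡⟨ ∑Fin₄.∑-cong (λ i → sym (ℤP.*-distribˡ-+ (TR i r) (c i) (TRe i))) ⟩
    sumFin 4 (λ i → TR i r * (c i + TRe i))
      ≡⟨ ∑Fin₄.∑-cong (λ i → trans (cong (_*_ (TR i r)) (TRe≡-c i)) (ℤP.*-zeroʳ (TR i r))) ⟩
    sumFin 4 (λ _ → 0ℤ)
      ≡⟨ ∑Fin₄.∑-zero ⟩
    0ℤ
      ∎
    where
    open ≡-Reasoning
    TRe : Fin 4 → ℤ
    TRe i = sumFin 4 (λ s → TR i s * e s)

  norm-combination : ∀ {k B} {T : (B → ℤ) → ℤ} → IsSummation T → (M : D k → B → ℤ) (N : ℤ) →
    (∀ u u′ → u′ ≢ u → T (λ t → M u t * M u′ t) ≡ 0ℤ) → (∀ u → T (λ t → M u t * M u t) ≡ N) →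
    ∀ (f : D k → ℤ) →
    T (λ t → sumD k (λ u → f u * M u t) * sumD k (λ u → f u * M u t)) ≡ sumD k (λ u → f u * f u) * N
  norm-combination {k} {T = T} isT M N orthogonal normalised f = begin
    T (λ t → sumD k (λ u → f u * M u t) * sumD k (λ u → f u * M u t))
      ≡⟨ ∑-cong isT (λ t → ∑D.∑-square (λ u → f u * M u t)) ⟩
    T (λ t → sumD k (λ u → sumD k (λ u′ → f u * M u t * (f u′ * M u′ t))))
      ≡⟨ sumD-comm isT k (λ u t → sumD k (λ u′ → f u * M u t * (f u′ * M u′ t))) ⟨
    sumD k (λ u → T (λ t → sumD k (λ u′ → f u * M u t * (f u′ * M u′ t))))
      ≡⟨ ∑D.∑-cong (λ u → sumD-comm isT k (λ u′ t → f u * M u t * (f u′ * M u′ t))) ⟨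
    sumD k (λ u → sumD k (λ u′ → T (λ t → f u * M u t * (f u′ * M u′ t))))
      ≡⟨ ∑D.∑-cong (λ u → ∑D.∑-cong λ u′ → pull-scalars u u′) ⟩
    sumD k (λ u → sumD k (λ u′ → f u * f u′ * T (λ t → M u t * M u′ t)))
      ≡⟨ ∑D.∑-cong (λ u → sumD-single _ u λ u′ u′≢u →
                      trans (cong (_*_ (f u * f u′)) (orthogonal u u′ u′≢u)) (ℤP.*-zeroʳ (f u * f u′))) ⟩
    sumD k (λ u → f u * f u * T (λ t → M u t * M u t))
      ≡⟨ ∑D.∑-cong (λ u → cong (_*_ (f u * f u)) (normalised u)) ⟩
    sumD k (λ u → f u * f u * N)
      ≡⟨ ∑D.*-distribʳ-∑ N (λ u → f u * f u) ⟨
    sumD k (λ u → f u * f u) * N ∎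
    where
    open ≡-Reasoning
    module ∑D = IsSummation (sumD-isSummation k)
    pull-scalars : ∀ u u′ →
      T (λ t → f u * M u t * (f u′ * M u′ t)) ≡ f u * f u′ * T (λ t → M u t * M u′ t)
    pull-scalars u u′ = trans (∑-cong isT λ t → *-interchange (f u) (M u t) (f u′) (M u′ t))
                              (sym (*-distribˡ-∑ isT (f u * f u′) (λ t → M u t * M u′ t)))

  module Kimura (k : ℕ) .{{_ : NonZero k}} (a b c d : ZD01 k) (yield : YieldKimura k a b c d) where

    private
      module ∑D = IsSummation (sumD-isSummation k)

    block : Fin 4 → ZD01 k
    block zero                = a
    block (suc zero)          = b
    block (suc (suc zero))    = c
    block (suc (suc (suc _))) = d

    H : Idx k → Idx k → ℤ
    H = kimuraH k a b c d

    H-block : ∀ s u v → H (inj₂ (zero , u)) (inj₂ (s , v)) ≡ pm k (block s) u v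
    H-block zero                u v = refl
    H-block (suc zero)          u v = refl
    H-block (suc (suc zero))    u v = refl
    H-block (suc (suc (suc _))) u v = refl

    rows-orthogonal : ∀ r s → s ≢ r → sumIdx k (λ t → H r t * H s t) ≡ 0ℤ
    rows-orthogonal r s s≢r =
      trans (yield r s) (cong (if_then + (8 ℕ.* k ℕ.+ 4) else 0ℤ) (dec-false (r ≟I s) (s≢r ∘ sym)))

    row-norm : ∀ r → sumIdx k (λ t → H r t * H r t) ≡ + (8 ℕ.* k ℕ.+ 4)
    row-norm r = trans (yield r r) (cong (if_then + (8 ℕ.* k ℕ.+ 4) else 0ℤ) (dec-true (r ≟I r) refl))

    border⊥blockRow : ∀ u i → sumFin 4 (λ s → TL i s * BL zero s)
                              + sumFin 4 (λ s → TR i s * (+ 2 * (weight k (block s) - + k))) ≡ 0ℤ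
    border⊥blockRow u i =
      trans (cong (_+_ (sumFin 4 (λ s → TL i s * BL zero s))) (∑Fin₄.∑-cong blockRowSum))
            (rows-orthogonal (inj₁ i) (inj₂ (zero , u)) λ ())
      where
      open ≡-Reasoning
      blockRowSum : ∀ s → TR i s * (+ 2 * (weight k (block s) - + k))
                          ≡ sumD k (λ v → TR i s * H (inj₂ (zero , u)) (inj₂ (s , v)))
      blockRowSum s = begin
        TR i s * (+ 2 * (weight k (block s) - + k))
          ≡⟨ cong (_*_ (TR i s)) (pm-rowSum k (block s) u) ⟨
        TR i s * sumD k (pm k (block s) u)
          ≡⟨ cong (_*_ (TR i s)) (∑D.∑-cong (H-block s u)) ⟨
        TR i s * sumD k (λ v → H (inj₂ (zero , u)) (inj₂ (s , v)))
          ≡⟨ ∑D.*-distribˡ-∑ (TR i s) (λ v → H (inj₂ (zero , u)) (inj₂ (s , v))) ⟩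
        sumD k (λ v → TR i s * H (inj₂ (zero , u)) (inj₂ (s , v)))
          ∎

    weights : D k → weight k a ≡ + k - 1ℤ × weight k b ≡ + k × weight k c ≡ + k × weight k d ≡ + k
    weights u = 8t+4·2[W-K]≡0⇒W≡K-t _ _ 1ℤ (solved zero)
              , unshifted (solved (suc zero))
              , unshifted (solved (suc (suc zero)))
              , unshifted (solved (suc (suc (suc zero))))
      where
      -- Evaluation turns the constant term of solved r into 8, 0, 0, 0 for r = 0, 1, 2, 3.
      solved : ∀ r → sumFin 4 (λ i → TR i r * sumFin 4 (λ s → TL i s * BL zero s))
                     + + 4 * (+ 2 * (weight k (block r) - + k)) ≡ 0ℤ
      solved = TR-solve (λ i → sumFin 4 (λ s → TL i s * BL zero s)) (λ s → + 2 * (weight k (block s) - + k))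
                        (border⊥blockRow u)
      unshifted : ∀ {W} → 0ℤ + + 4 * (+ 2 * (W - + k)) ≡ 0ℤ → W ≡ + k
      unshifted h = trans (8t+4·2[W-K]≡0⇒W≡K-t _ _ 0ℤ h) (ℤP.+-identityʳ (+ k))

    χ-block : Fin 4 → ℤ
    χ-block s = signedWeight k (block s)

    χ-combination : Idx k → ℤ
    χ-combination t = sumD k (λ u → χ u * H (inj₂ (zero , u)) t)

    ‖χ-combination‖²-by-rows :
      sumIdx k (λ t → χ-combination t * χ-combination t) ≡ + k * (1ℤ + 1ℤ) * + (8 ℕ.* k ℕ.+ 4)
    ‖χ-combination‖²-by-rows =
      trans (norm-combination (sumIdx-isSummation k) (λ u → H (inj₂ (zero , u))) (+ (8 ℕ.* k ℕ.+ 4))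
               (λ u u′ u′≢u → rows-orthogonal (inj₂ (zero , u)) (inj₂ (zero , u′))
                                               λ { refl → u′≢u refl })
               (λ u → row-norm (inj₂ (zero , u))) χ)
            (cong (_* + (8 ℕ.* k ℕ.+ 4)) (trans (∑D.∑-cong χ*χ≡1) (sumD-const k 1ℤ)))

    ‖χ-combination‖²-by-columns : sumIdx k (λ t → χ-combination t * χ-combination t)
                                  ≡ + k * (+ 8 * sumFin 4 (λ s → χ-block s * χ-block s))
    ‖χ-combination‖²-by-columns = begin
      sumFin 4 (λ r → χ-combination (inj₁ r) * χ-combination (inj₁ r))
        + sumFin 4 (λ s → sumD k (λ v → χ-combination (inj₂ (s , v)) * χ-combination (inj₂ (s , v))))
        ≡⟨ cong₂ _+_ (trans (∑Fin₄.∑-cong λ r → cong₂ _*_ (border r) (border r)) ∑Fin₄.∑-zero)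
                     (∑Fin₄.∑-cong blockColumns) ⟩
      0ℤ + sumFin 4 (λ s → + k * (+ 8 * (χ-block s * χ-block s)))
        ≡⟨ ℤP.+-identityˡ _ ⟩
      sumFin 4 (λ s → + k * (+ 8 * (χ-block s * χ-block s)))
        ≡⟨ ∑Fin₄.*-distribˡ-∑ (+ k) (λ s → + 8 * (χ-block s * χ-block s)) ⟨
      + k * sumFin 4 (λ s → + 8 * (χ-block s * χ-block s))
        ≡⟨ cong (_*_ (+ k)) (∑Fin₄.*-distribˡ-∑ (+ 8) (λ s → χ-block s * χ-block s)) ⟨
      + k * (+ 8 * sumFin 4 (λ s → χ-block s * χ-block s))
        ∎
      where
      open ≡-Reasoning
      border : ∀ r → χ-combination (inj₁ r) ≡ 0ℤ
      border r = trans (sym (∑D.*-distribʳ-∑ (BL zero r) χ))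
                       (trans (cong (_* BL zero r) (sumD-χ k)) (ℤP.*-zeroˡ (BL zero r)))
      column : ∀ s v → χ-combination (inj₂ (s , v)) ≡ + 2 * (χ v * χ-block s)
      column s v = trans (∑D.∑-cong λ u → cong (χ u *_) (H-block s u v)) (χ-pm-colSum k (block s) v)
      square : ∀ x y → x * x ≡ 1ℤ → + 2 * (x * y) * (+ 2 * (x * y)) ≡ + 4 * (y * y)
      square x y x²≡1 = trans (regroup x y) (trans (cong (_* (+ 4 * (y * y))) x²≡1) (ℤP.*-identityˡ _))
        where
        regroup : ∀ x y → + 2 * (x * y) * (+ 2 * (x * y)) ≡ x * x * (+ 4 * (y * y))
        regroup = solve-∀
      blockColumns : ∀ s → sumD k (λ v → χ-combination (inj₂ (s , v)) * χ-combination (inj₂ (s , v)))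
                           ≡ + k * (+ 8 * (χ-block s * χ-block s))
      blockColumns s = begin
        sumD k (λ v → χ-combination (inj₂ (s , v)) * χ-combination (inj₂ (s , v)))
          ≡⟨ ∑D.∑-cong (λ v → trans (cong₂ _*_ (column s v) (column s v))
                                    (square (χ v) (χ-block s) (χ*χ≡1 v))) ⟩
        sumD k (λ _ → + 4 * (χ-block s * χ-block s))
          ≡⟨ sumD-const k (+ 4 * (χ-block s * χ-block s)) ⟩
        + k * (+ 4 * (χ-block s * χ-block s) + + 4 * (χ-block s * χ-block s))
          ≡⟨ cong (_*_ (+ k)) (double (χ-block s * χ-block s)) ⟩
        + k * (+ 8 * (χ-block s * χ-block s))
          ∎
        where
        double : ∀ q → + 4 * q + + 4 * q ≡ + 8 * q
        double = solve-∀

    sum-χ-block²≡2k+1 : sumFin 4 (λ s → χ-block s * χ-block s) ≡ + (2 ℕ.* k ℕ.+ 1)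
    sum-χ-block²≡2k+1 =
      ℤP.*-cancelˡ-≡ (+ 8) _ _ (ℤP.*-cancelˡ-≡ (+ k) _ _ (begin
        + k * (+ 8 * sumFin 4 (λ s → χ-block s * χ-block s))
          ≡⟨ ‖χ-combination‖²-by-columns ⟨
        sumIdx k (λ t → χ-combination t * χ-combination t)
          ≡⟨ ‖χ-combination‖²-by-rows ⟩
        + k * (1ℤ + 1ℤ) * + (8 ℕ.* k ℕ.+ 4)
          ≡⟨ cong (λ x → + k * (1ℤ + 1ℤ) * (x + + 4)) (ℤP.pos-* 8 k) ⟩
        + k * (1ℤ + 1ℤ) * (+ 8 * + k + + 4)
          ≡⟨ regroup (+ k) ⟩
        + k * (+ 8 * (+ 2 * + k + 1ℤ))
          ≡⟨ cong (λ x → + k * (+ 8 * (x + 1ℤ))) (ℤP.pos-* 2 k) ⟨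
        + k * (+ 8 * + (2 ℕ.* k ℕ.+ 1))
          ∎))
      where
      open ≡-Reasoning
      regroup : ∀ K → K * (1ℤ + 1ℤ) * (+ 8 * K + + 4) ≡ K * (+ 8 * (+ 2 * K + 1ℤ))
      regroup = solve-∀

    block-halves< : ∀ s {x} → weight k (block s) ≡ + x → 2 ℕ.* k ℕ.+ 1 < x ℕ.* x →
      supp₁ k (block s) < x × supp₂ k (block s) < x
    block-halves< s |w|≡x 2k+1<x² =
      halves<weight k (block s) |w|≡x (ℤP.≤-<-trans χ-block²≤2k+1 (ℤ.+<+ 2k+1<x²))
      where
      χ-block²≤2k+1 : χ-block s * χ-block s ℤ.≤ + (2 ℕ.* k ℕ.+ 1)
      χ-block²≤2k+1 = subst (χ-block s * χ-block s ℤ.≤_) sum-χ-block²≡2k+1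
        (≤-sumFin 4 (λ r → χ-block r * χ-block r) (λ r → square-nonneg (χ-block r)) s)

open import Data.Nat using (_+_; _*_)

-- Matching k as a successor lets + k - 1ℤ compute to + (k ∸ 1).
lemma2p3 : (k : ℕ) .{{_ : NonZero k}} → 5 ≤ k → ∃ (λ n → k ≡ 2 * n + 1) →
    (a b c d : ZD01 k) → YieldKimura k a b c d →
      (supp₁ k a < k ∸ 1 × supp₂ k a < k ∸ 1)
      × (supp₁ k b < k × supp₂ k b < k)
      × (supp₁ k c < k × supp₂ k c < k)
      × (supp₁ k d < k × supp₂ k d < k)
lemma2p3 k@(suc _) 5≤k _ a b c d yield =
  let |a|≡k-1 , |b|≡k , |c|≡k , |d|≡k = weights (zero , false) in
    block-halves< zero                   |a|≡k-1 (2k+1<[k∸1]² 5≤k)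
  , block-halves< (suc zero)             |b|≡k   (2k+1<k² 5≤k)
  , block-halves< (suc (suc zero))       |c|≡k   (2k+1<k² 5≤k)
  , block-halves< (suc (suc (suc zero))) |d|≡k   (2k+1<k² 5≤k)
  where open Kimura k a b c d yield
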